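{- The list $\{1^a,2^b,3^c,4^d\}$ admits a standard linear realization in each of the following cases: (1) $a\geq 3$, $b\geq 0$ even, $0\leq c\leq a-3$ and $d\geq 0$; (2) $a\geq 2$, $b\geq 1$ odd, $0\leq c\leq a-2$ and $d\geq 0$; (3) $a\geq 2$, $b\geq 0$ even, $2\leq c\leq a$ and $d\geq 0$ even.
   Context: The notation $\{1^{a_1},\ldots,t^{a_t}\}$ denotes the multiset with $a_i$ copies of $i$; all exponents are integers. For a list (multiset) $L$ of positive integers with $|L|$ elements, a linear realization of $L$ is an ordering $[x_0,\ldots,x_{|L|}]$ of $\{0,1,\ldots,|L|\}$ such that the multiset $\{|x_i-x_{i+1}|:0\le i\le |L|-1\}$ equals $L$; it is standard if $x_0=0$. -}

module Defs where

open import Data.Nat using (ℕ; zero; suc; _+_; ∣_-_∣)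
open import Data.List using (List; []; _∷_; _++_; replicate; length; upTo)
open import Data.Product using (Σ; _×_; ∃)
open import Relation.Binary.PropositionalEquality using (_≡_)
open import Data.List.Relation.Binary.Permutation.Propositional using (_↭_)

-- The multiset {1^a, 2^b, 3^c, 4^d}, represented as a list (multisets are
-- compared up to permutation below).
list1234 : ℕ → ℕ → ℕ → ℕ → List ℕ
list1234 a b c d = replicate a 1 ++ replicate b 2 ++ replicate c 3 ++ replicate d 4

diffs : List ℕ → List ℕ
diffs [] = []
diffs (x ∷ []) = []
diffs (x ∷ y ∷ xs) = ∣ x - y ∣ ∷ diffs (y ∷ xs)

-- A linear realization of L: an ordering xs of {0,1,...,|L|} (i.e. a
-- permutation of upTo (|L|+1)) whose multiset of consecutive absolute
-- differences equals L.
IsLinearRealization : List ℕ → List ℕ → Set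
IsLinearRealization L xs = (xs ↭ upTo (suc (length L))) × (diffs xs ↭ L)

IsStandardLinearRealization : List ℕ → List ℕ → Set
IsStandardLinearRealization L xs =
  IsLinearRealization L xs × (Σ (List ℕ) λ ys → xs ≡ 0 ∷ ys)

HasStandardLinearRealization : List ℕ → Set
HasStandardLinearRealization L = ∃ λ xs → IsStandardLinearRealization L xs

module Submission where

-- The argument builds realizations from a few explicit ones by operations
-- that enlarge the list in a controlled way.
--  * Prepending a block (glue): if 0 p₁ … pₖ₋₁ orders {0,…,k-1} and S is a
--    standard realization of L, then 0 p₁ … pₖ₋₁ followed by S + k is one of
--    (differences of 0 p₁ … pₖ₋₁ k) ++ L.  With four fixed blocks this adds
--    {1}, {1²,3²}, {1,2²,3} or {1,2³,4}.
--  * Two twos: if S ends in 1, then 0, S + 2, 1 realizes {2²} ++ L and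
--    again ends in 1.
--  * Four fours: if the four largest entries of S occur as two adjacent
--    pairs x y, x' y', inserting x+4, y+4 and x'+4, y'+4 between them adds
--    {4⁴}, and the new largest entries again form two adjacent pairs.
-- Explicit realizations for d < 8 (or d < 8 even), checked by a decision
-- procedure, then give families over all d; the remaining parameters are
-- reached by the other operations, and the theorem is a case analysis.

open import Defs
open import Data.Bool using (T)
open import Data.Nat using (ℕ; zero; suc; _+_; _*_; _∸_; _≤_; ∣_-_∣; _≟_; s≤s; z≤n; _≤‴_; ≤‴-refl; ≤‴-step)
open import Data.Nat.Properties using (+-identityʳ; +-suc; +-comm; ∣-∣-comm; ∣m-m+n∣≡n; ∣m+n-m+o∣≡∣n-o∣; ≤⇒≤‴)
open import Data.Nat.Divisibility using (_∣_; divides)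
open import Data.Product using (_×_; _,_; Σ; ∃₂)
open import Data.Sum using (_⊎_; inj₁; inj₂)
open import Data.Maybe using (Maybe; just; nothing; is-just; to-witness-T)
open import Data.List using (List; []; _∷_; _++_; _∷ʳ_; map; replicate; length; upTo; applyUpTo)
open import Data.List.Properties using (++-assoc; map-++; length-++; length-upTo; map-upTo)
open import Data.List.Relation.Binary.Permutation.Propositional using (_↭_; ↭-refl; ↭-sym; ↭-trans; ↭-reflexive; prep; swap; module PermutationReasoning)
open import Data.List.Relation.Binary.Permutation.Propositional.Properties using (shift; shifts; ++⁺ˡ; ++⁺ʳ; map⁺; ↭-length; ++-comm)
open import Relation.Binary.PropositionalEquality using (_≡_; refl; sym; trans; cong; cong₂; subst; module ≡-Reasoning)
open import Relation.Nullary using (¬_; yes; no; contradiction)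

-- A standard realization of L whose last entry is 1; this is the shape on
-- which the two-twos operation acts.
OneEnded : List ℕ → Set
OneEnded L = Σ (List ℕ) λ S₁ → IsStandardLinearRealization L (0 ∷ S₁ ++ 1 ∷ [])

-- The list {1^a, 2^b, 3^c, 4^d} admits a standard linear realization (ending
-- in 1).  Records, so that the counts can be inferred from the type.
record Realizable (a b c d : ℕ) : Set where
  constructor realizable
  field witness : HasStandardLinearRealization (list1234 a b c d)

record Realizable₁ (a b c d : ℕ) : Set where
  constructor realizable₁
  field witness₁ : OneEnded (list1234 a b c d)

-- Certified checking of concrete lists: `perm?` and `standard?` return a
-- proof when the claim holds, and `by-computation` extracts it, its implicit
-- argument T (is-just …) being the unit type exactly when the check succeeds.

find : (x : ℕ) (ys : List ℕ) → Maybe (∃₂ λ p q → ys ≡ p ++ x ∷ q)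
find x [] = nothing
find x (y ∷ ys) with x ≟ y | find x ys
... | yes refl | _ = just ([] , ys , refl)
... | no _ | just (p , q , eq) = just (y ∷ p , q , cong (y ∷_) eq)
... | no _ | nothing = nothing

perm? : (xs ys : List ℕ) → Maybe (xs ↭ ys)
perm? [] [] = just ↭-refl
perm? [] (_ ∷ _) = nothing
perm? (x ∷ xs) ys with find x ys
... | nothing = nothing
... | just (p , q , refl) with perm? xs (p ++ q)
...   | nothing = nothing
...   | just xs↭pq = just (↭-trans (prep x xs↭pq) (↭-sym (shift x p q)))

standard? : (L S : List ℕ) → Maybe (IsStandardLinearRealization L S)
standard? L [] = nothing
standard? L (x ∷ S) with x ≟ 0 | perm? (x ∷ S) (upTo (suc (length L))) | perm? (diffs (x ∷ S)) L
... | yes refl | just positions | just differences = just ((positions , differences) , (S , refl))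
... | _ | _ | _ = nothing

by-computation : {A : Set} (m : Maybe A) → {T (is-just m)} → A
by-computation m {ok} = to-witness-T m ok

checked : {xs ys : List ℕ} → {T (is-just (perm? xs ys))} → xs ↭ ys
checked {xs} {ys} {ok} = by-computation (perm? xs ys) {ok}

applyUpTo-+ : ∀ {A : Set} (f : ℕ → A) k n → applyUpTo f (k + n) ≡ applyUpTo f k ++ applyUpTo (λ i → f (k + i)) n
applyUpTo-+ f zero n = refl
applyUpTo-+ f (suc k) n = cong (f 0 ∷_) (applyUpTo-+ (λ i → f (suc i)) k n)

upTo-+ : ∀ k n → upTo (k + n) ≡ upTo k ++ map (k +_) (upTo n)
upTo-+ k n = trans (applyUpTo-+ (λ i → i) k n) (cong (upTo k ++_) (sym (map-upTo (k +_) n)))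

diffs-++ : ∀ xs y ys → diffs (xs ++ y ∷ ys) ≡ diffs (xs ∷ʳ y) ++ diffs (y ∷ ys)
diffs-++ [] y ys = refl
diffs-++ (x ∷ []) y ys = refl
diffs-++ (x ∷ x′ ∷ xs) y ys = cong (∣ x - x′ ∣ ∷_) (diffs-++ (x′ ∷ xs) y ys)

diffs-shift : ∀ k xs → diffs (map (k +_) xs) ≡ diffs xs
diffs-shift k [] = refl
diffs-shift k (x ∷ []) = refl
diffs-shift k (x ∷ y ∷ xs) = cong₂ _∷_ (∣m+n-m+o∣≡∣n-o∣ k x y) (diffs-shift k (y ∷ xs))

length-diffs-∷ʳ : ∀ xs y → length (diffs (xs ∷ʳ y)) ≡ length xs
length-diffs-∷ʳ [] y = refl
length-diffs-∷ʳ (x ∷ []) y = refl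
length-diffs-∷ʳ (x ∷ x′ ∷ xs) y = cong suc (length-diffs-∷ʳ (x′ ∷ xs) y)

replicate-+ : ∀ {A : Set} m n (x : A) → replicate (m + n) x ≡ replicate m x ++ replicate n x
replicate-+ zero n x = refl
replicate-+ (suc m) n x = cong (x ∷_) (replicate-+ m n x)

interchange : ∀ {E : Set} (A R A′ R′ : List E) → (A ++ R) ++ (A′ ++ R′) ↭ (A ++ A′) ++ (R ++ R′)
interchange A R A′ R′ = begin
  (A ++ R) ++ A′ ++ R′  ≡⟨ ++-assoc A R _ ⟩
  A ++ R ++ A′ ++ R′    ↭⟨ ++⁺ˡ A (shifts R A′) ⟩
  A ++ A′ ++ R ++ R′    ≡⟨ ++-assoc A A′ _ ⟨
  (A ++ A′) ++ R ++ R′  ∎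
  where open PermutationReasoning

list1234-++ : ∀ a b c d a′ b′ c′ d′ →
  list1234 a b c d ++ list1234 a′ b′ c′ d′ ↭ list1234 (a + a′) (b + b′) (c + c′) (d + d′)
list1234-++ a b c d a′ b′ c′ d′ = begin
  list1234 a b c d ++ list1234 a′ b′ c′ d′
    ↭⟨ interchange (replicate a 1) _ (replicate a′ 1) _ ⟩
  (replicate a 1 ++ replicate a′ 1) ++ (replicate b 2 ++ C ++ D) ++ (replicate b′ 2 ++ C′ ++ D′)
    ↭⟨ ++⁺ˡ (replicate a 1 ++ replicate a′ 1) (interchange (replicate b 2) _ (replicate b′ 2) _) ⟩
  (replicate a 1 ++ replicate a′ 1) ++ (replicate b 2 ++ replicate b′ 2) ++ (C ++ D) ++ (C′ ++ D′)
    ↭⟨ ++⁺ˡ (replicate a 1 ++ replicate a′ 1) (++⁺ˡ (replicate b 2 ++ replicate b′ 2)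
         (interchange (replicate c 3) _ (replicate c′ 3) _)) ⟩
  (replicate a 1 ++ replicate a′ 1) ++ (replicate b 2 ++ replicate b′ 2) ++ (C ++ C′) ++ (D ++ D′)
    ≡⟨ cong₂ _++_ (replicate-+ a a′ 1) (cong₂ _++_ (replicate-+ b b′ 2)
         (cong₂ _++_ (replicate-+ c c′ 3) (replicate-+ d d′ 4))) ⟨
  list1234 (a + a′) (b + b′) (c + c′) (d + d′) ∎
  where
  open PermutationReasoning
  C = replicate c 3
  D = replicate d 4
  C′ = replicate c′ 3
  D′ = replicate d′ 4

transport : ∀ {L L′ S} → IsStandardLinearRealization L S → L ↭ L′ → IsStandardLinearRealization L′ S
transport {S = S} ((positions , differences) , standard) L↭L′ =
  (subst (λ n → S ↭ upTo (suc n)) (↭-length L↭L′) positions , ↭-trans differences L↭L′) , standard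

glue : ∀ {L S} p k → 0 ∷ p ↭ upTo k → IsStandardLinearRealization L S →
  IsStandardLinearRealization (diffs ((0 ∷ p) ∷ʳ k) ++ L) ((0 ∷ p) ++ map (k +_) S)
glue {L} {.(0 ∷ ys)} p k block ((positions , differences) , (ys , refl)) =
  (positions′ , differences′) , (p ++ map (k +_) (0 ∷ ys) , refl)
  where
  B = diffs ((0 ∷ p) ∷ʳ k)
  size : k + suc (length L) ≡ suc (length (B ++ L))
  size = begin
    k + suc (length L)             ≡⟨ +-suc k (length L) ⟩
    suc (k + length L)             ≡⟨ cong (λ n → suc (n + length L)) (trans (sym (length-upTo k)) (sym (↭-length block))) ⟩
    suc (length (0 ∷ p) + length L) ≡⟨ cong (λ n → suc (n + length L)) (sym (length-diffs-∷ʳ (0 ∷ p) k)) ⟩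
    suc (length B + length L)      ≡⟨ cong suc (length-++ B) ⟨
    suc (length (B ++ L))          ∎
    where open ≡-Reasoning
  positions′ : (0 ∷ p) ++ map (k +_) (0 ∷ ys) ↭ upTo (suc (length (B ++ L)))
  positions′ = begin
    (0 ∷ p) ++ map (k +_) (0 ∷ ys)              ↭⟨ ++⁺ʳ _ block ⟩
    upTo k ++ map (k +_) (0 ∷ ys)               ↭⟨ ++⁺ˡ (upTo k) (map⁺ (k +_) positions) ⟩
    upTo k ++ map (k +_) (upTo (suc (length L))) ≡⟨ upTo-+ k (suc (length L)) ⟨
    upTo (k + suc (length L))                   ≡⟨ cong upTo size ⟩
    upTo (suc (length (B ++ L)))                ∎
    where open PermutationReasoning
  differences′ : diffs ((0 ∷ p) ++ map (k +_) (0 ∷ ys)) ↭ B ++ L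
  differences′ = begin
    diffs ((0 ∷ p) ++ map (k +_) (0 ∷ ys))                 ≡⟨ diffs-++ (0 ∷ p) (k + 0) (map (k +_) ys) ⟩
    diffs ((0 ∷ p) ∷ʳ (k + 0)) ++ diffs (map (k +_) (0 ∷ ys)) ≡⟨ cong₂ _++_ (cong (λ n → diffs ((0 ∷ p) ∷ʳ n)) (+-identityʳ k)) (diffs-shift k (0 ∷ ys)) ⟩
    B ++ diffs (0 ∷ ys)                                     ↭⟨ ++⁺ˡ B differences ⟩
    B ++ L                                                  ∎
    where open PermutationReasoning

prependBlock : ∀ {a b c d} p k a′ b′ c′ d′ → 0 ∷ p ↭ upTo k → diffs ((0 ∷ p) ∷ʳ k) ↭ list1234 a′ b′ c′ d′ →
  Realizable a b c d → Realizable (a′ + a) (b′ + b) (c′ + c) (d′ + d)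
prependBlock {a} {b} {c} {d} p k a′ b′ c′ d′ block blockDiffs (realizable (S , realization)) =
  realizable (_ , transport (glue p k block realization)
                    (↭-trans (++⁺ʳ _ blockDiffs) (list1234-++ a′ b′ c′ d′ a b c d)))

addOne : ∀ {a b c d} → Realizable a b c d → Realizable (suc a) b c d
addOne = prependBlock [] 1 1 0 0 0 checked checked

addOnesThrees : ∀ {a b c d} → Realizable a b c d → Realizable (2 + a) b (2 + c) d
addOnesThrees = prependBlock (3 ∷ 2 ∷ 1 ∷ []) 4 2 0 2 0 checked checked

addOneTwosThree : ∀ {a b c d} → Realizable a b c d → Realizable (1 + a) (2 + b) (1 + c) d
addOneTwosThree = prependBlock (3 ∷ 1 ∷ 2 ∷ []) 4 1 2 1 0 checked checked

addOneTwosFour : ∀ {a b c d} → Realizable a b c d → Realizable (1 + a) (3 + b) c (1 + d)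
addOneTwosFour = prependBlock (2 ∷ 4 ∷ 3 ∷ 1 ∷ []) 5 1 3 0 1 checked checked

transportOneEnded : ∀ {L L′} → OneEnded L → L ↭ L′ → OneEnded L′
transportOneEnded (S₁ , realization) L↭L′ = S₁ , transport realization L↭L′

-- Two twos.  If S = 0 S₁ 1 realizes L, then 0 (S + 2) 1 = 0 2 (S₁ + 2) 3 1
-- realizes {2,2} ++ L: the new differences are 2 at both ends.
addTwoTwos : ∀ {L} → OneEnded L → OneEnded (2 ∷ 2 ∷ L)
addTwoTwos {L} (S₁ , (positions , differences) , _) = map (2 +_) S , (positions′ , differences′) , (_ , refl)
  where
  S = 0 ∷ S₁ ++ 1 ∷ []
  positions′ : 0 ∷ map (2 +_) S ++ 1 ∷ [] ↭ upTo (suc (length (2 ∷ 2 ∷ L)))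
  positions′ = begin
    0 ∷ map (2 +_) S ++ 1 ∷ []                   ↭⟨ prep 0 (++-comm (map (2 +_) S) (1 ∷ [])) ⟩
    0 ∷ 1 ∷ map (2 +_) S                         ↭⟨ prep 0 (prep 1 (map⁺ (2 +_) positions)) ⟩
    upTo 2 ++ map (2 +_) (upTo (suc (length L))) ≡⟨ upTo-+ 2 (suc (length L)) ⟨
    upTo (2 + suc (length L))                    ∎
    where open PermutationReasoning
  regroup : 0 ∷ map (2 +_) S ++ 1 ∷ [] ≡ (0 ∷ map (2 +_) (0 ∷ S₁)) ++ 3 ∷ 1 ∷ []
  regroup = cong (0 ∷_) (trans (cong (_++ 1 ∷ []) (map-++ (2 +_) (0 ∷ S₁) (1 ∷ [])))
                               (++-assoc (map (2 +_) (0 ∷ S₁)) (3 ∷ []) (1 ∷ [])))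
  differences′ : diffs (0 ∷ map (2 +_) S ++ 1 ∷ []) ↭ 2 ∷ 2 ∷ L
  differences′ = begin
    diffs (0 ∷ map (2 +_) S ++ 1 ∷ [])             ≡⟨ cong diffs regroup ⟩
    diffs ((0 ∷ map (2 +_) (0 ∷ S₁)) ++ 3 ∷ 1 ∷ []) ≡⟨ diffs-++ (0 ∷ map (2 +_) (0 ∷ S₁)) 3 (1 ∷ []) ⟩
    2 ∷ diffs (map (2 +_) (0 ∷ S₁) ∷ʳ 3) ++ 2 ∷ []  ≡⟨ cong (λ xs → 2 ∷ diffs xs ++ 2 ∷ []) (map-++ (2 +_) (0 ∷ S₁) (1 ∷ [])) ⟨
    2 ∷ diffs (map (2 +_) S) ++ 2 ∷ []              ≡⟨ cong (λ xs → 2 ∷ xs ++ 2 ∷ []) (diffs-shift 2 S) ⟩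
    2 ∷ diffs S ++ 2 ∷ []                           ↭⟨ prep 2 (++-comm (diffs S) (2 ∷ [])) ⟩
    2 ∷ 2 ∷ diffs S                                 ↭⟨ prep 2 (prep 2 differences) ⟩
    2 ∷ 2 ∷ L                                       ∎
    where open PermutationReasoning

addTwoTwosAt : ∀ {a b c d} → Realizable₁ a b c d → Realizable₁ a (2 + b) c d
addTwoTwosAt {a} {b} {c} {d} (realizable₁ r) = realizable₁ (transportOneEnded (addTwoTwos r) (list1234-++ 0 2 0 0 a b c d))

forgetEnd : ∀ {a b c d} → Realizable₁ a b c d → Realizable a b c d
forgetEnd (realizable₁ (S₁ , realization)) = realizable (_ , realization)

bring2 : ∀ {A : Set} (a p q : A) R → a ∷ p ∷ q ∷ R ↭ p ∷ q ∷ a ∷ R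
bring2 a p q R = ↭-trans (swap a p ↭-refl) (prep p (swap a q ↭-refl))

insert-↭ : ∀ {A : Set} U (x p q y : A) R → U ++ x ∷ p ∷ q ∷ y ∷ R ↭ p ∷ q ∷ U ++ x ∷ y ∷ R
insert-↭ [] x p q y R = bring2 x p q (y ∷ R)
insert-↭ (u ∷ U) x p q y R = ↭-trans (prep u (insert-↭ U x p q y R)) (bring2 u p q _)

insertTwice-↭ : ∀ {A : Set} U (x p q y : A) V (x′ p′ q′ y′ : A) R →
  U ++ x ∷ p ∷ q ∷ y ∷ V ++ x′ ∷ p′ ∷ q′ ∷ y′ ∷ R ↭ p ∷ q ∷ p′ ∷ q′ ∷ U ++ x ∷ y ∷ V ++ x′ ∷ y′ ∷ R
insertTwice-↭ U x p q y V x′ p′ q′ y′ R = begin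
  U ++ x ∷ p ∷ q ∷ y ∷ V ++ x′ ∷ p′ ∷ q′ ∷ y′ ∷ R     ↭⟨ insert-↭ U x p q y _ ⟩
  p ∷ q ∷ U ++ x ∷ y ∷ V ++ x′ ∷ p′ ∷ q′ ∷ y′ ∷ R     ≡⟨ cong (λ s → p ∷ q ∷ s) (++-assoc U (x ∷ y ∷ V) _) ⟨
  p ∷ q ∷ (U ++ x ∷ y ∷ V) ++ x′ ∷ p′ ∷ q′ ∷ y′ ∷ R   ↭⟨ prep p (prep q (insert-↭ (U ++ x ∷ y ∷ V) x′ p′ q′ y′ R)) ⟩
  p ∷ q ∷ p′ ∷ q′ ∷ (U ++ x ∷ y ∷ V) ++ x′ ∷ y′ ∷ R   ≡⟨ cong (λ s → p ∷ q ∷ p′ ∷ q′ ∷ s) (++-assoc U (x ∷ y ∷ V) _) ⟩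
  p ∷ q ∷ p′ ∷ q′ ∷ U ++ x ∷ y ∷ V ++ x′ ∷ y′ ∷ R     ∎
  where open PermutationReasoning

gap4 : ∀ x → ∣ x - 4 + x ∣ ≡ 4
gap4 x = trans (cong (∣ x -_∣) (+-comm 4 x)) (∣m-m+n∣≡n x 4)

-- Inserting x+4, y+4 between adjacent entries x y replaces the difference
-- |x-y| by 4, |x-y|, 4.
insert-diffs : ∀ U x y R → diffs (U ++ x ∷ 4 + x ∷ 4 + y ∷ y ∷ R) ↭ 4 ∷ 4 ∷ diffs (U ++ x ∷ y ∷ R)
insert-diffs [] x y R =
  ↭-trans (↭-reflexive (cong₂ (λ g h → g ∷ ∣ x - y ∣ ∷ h ∷ diffs (y ∷ R)) (gap4 x) (trans (∣-∣-comm (4 + y) y) (gap4 y))))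
          (prep 4 (swap ∣ x - y ∣ 4 ↭-refl))
insert-diffs (u ∷ []) x y R = ↭-trans (prep _ (insert-diffs [] x y R)) (bring2 _ 4 4 _)
insert-diffs (u ∷ v ∷ U) x y R = ↭-trans (prep _ (insert-diffs (v ∷ U) x y R)) (bring2 _ 4 4 _)

insertTwice-diffs : ∀ U x y V x′ y′ R →
  diffs (U ++ x ∷ 4 + x ∷ 4 + y ∷ y ∷ V ++ x′ ∷ 4 + x′ ∷ 4 + y′ ∷ y′ ∷ R) ↭ 4 ∷ 4 ∷ 4 ∷ 4 ∷ diffs (U ++ x ∷ y ∷ V ++ x′ ∷ y′ ∷ R)
insertTwice-diffs U x y V x′ y′ R = begin
  diffs (U ++ x ∷ 4 + x ∷ 4 + y ∷ y ∷ V ++ x′ ∷ 4 + x′ ∷ 4 + y′ ∷ y′ ∷ R)   ↭⟨ insert-diffs U x y _ ⟩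
  4 ∷ 4 ∷ diffs (U ++ x ∷ y ∷ V ++ x′ ∷ 4 + x′ ∷ 4 + y′ ∷ y′ ∷ R)           ≡⟨ cong (λ s → 4 ∷ 4 ∷ diffs s) (++-assoc U (x ∷ y ∷ V) _) ⟨
  4 ∷ 4 ∷ diffs ((U ++ x ∷ y ∷ V) ++ x′ ∷ 4 + x′ ∷ 4 + y′ ∷ y′ ∷ R)         ↭⟨ prep 4 (prep 4 (insert-diffs (U ++ x ∷ y ∷ V) x′ y′ R)) ⟩
  4 ∷ 4 ∷ 4 ∷ 4 ∷ diffs ((U ++ x ∷ y ∷ V) ++ x′ ∷ y′ ∷ R)                   ≡⟨ cong (λ s → 4 ∷ 4 ∷ 4 ∷ 4 ∷ diffs s) (++-assoc U (x ∷ y ∷ V) _) ⟩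
  4 ∷ 4 ∷ 4 ∷ 4 ∷ diffs (U ++ x ∷ y ∷ V ++ x′ ∷ y′ ∷ R)                     ∎
  where open PermutationReasoning

-- If the four largest entries m,…,m+3 of a standard realization
-- of L occur as adjacent pairs α β and γ δ, inserting α+4, β+4 and γ+4, δ+4
-- between them gives a standard realization of {4⁴} ++ L: the new entries
-- are exactly m+4,…,m+7 and the new differences are four 4s.
insertFours : ∀ {L} m X α β Y γ δ Z → length L ≡ 3 + m → α ∷ β ∷ γ ∷ δ ∷ [] ↭ map (m +_) (upTo 4) →
  IsStandardLinearRealization L (0 ∷ X ++ α ∷ β ∷ Y ++ γ ∷ δ ∷ Z) →
  IsStandardLinearRealization (4 ∷ 4 ∷ 4 ∷ 4 ∷ L) (0 ∷ X ++ α ∷ 4 + α ∷ 4 + β ∷ β ∷ Y ++ γ ∷ 4 + γ ∷ 4 + δ ∷ δ ∷ Z)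
insertFours {L} m X α β Y γ δ Z size largest ((positions , differences) , _) = (positions′ , differences′) , (_ , refl)
  where
  open PermutationReasoning
  new = 0 ∷ X ++ α ∷ 4 + α ∷ 4 + β ∷ β ∷ Y ++ γ ∷ 4 + γ ∷ 4 + δ ∷ δ ∷ Z
  top = 4 + α ∷ 4 + β ∷ 4 + γ ∷ 4 + δ ∷ []
  positions′ : new ↭ upTo (suc (length (4 ∷ 4 ∷ 4 ∷ 4 ∷ L)))
  positions′ = begin
    new                                      ↭⟨ insertTwice-↭ (0 ∷ X) α (4 + α) (4 + β) β Y γ (4 + γ) (4 + δ) δ Z ⟩
    top ++ 0 ∷ X ++ α ∷ β ∷ Y ++ γ ∷ δ ∷ Z    ↭⟨ ++⁺ˡ top positions ⟩
    top ++ upTo (suc (length L))             ↭⟨ ++-comm top _ ⟩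
    upTo (suc (length L)) ++ top             ≡⟨ cong (λ n → upTo (suc n) ++ top) size ⟩
    upTo (4 + m) ++ top                      ↭⟨ ++⁺ˡ (upTo (4 + m)) (map⁺ (4 +_) largest) ⟩
    upTo (4 + m) ++ map (4 + m +_) (upTo 4)  ≡⟨ upTo-+ (4 + m) 4 ⟨
    upTo (4 + m + 4)                         ≡⟨ cong upTo (+-comm (4 + m) 4) ⟩
    upTo (8 + m)                             ≡⟨ cong (λ n → upTo (5 + n)) size ⟨
    upTo (suc (length (4 ∷ 4 ∷ 4 ∷ 4 ∷ L)))   ∎
  differences′ : diffs new ↭ 4 ∷ 4 ∷ 4 ∷ 4 ∷ L
  differences′ = begin
    diffs new                                            ↭⟨ insertTwice-diffs (0 ∷ X) α β Y γ δ Z ⟩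
    4 ∷ 4 ∷ 4 ∷ 4 ∷ diffs (0 ∷ X ++ α ∷ β ∷ Y ++ γ ∷ δ ∷ Z) ↭⟨ prep 4 (prep 4 (prep 4 (prep 4 differences))) ⟩
    4 ∷ 4 ∷ 4 ∷ 4 ∷ L                                     ∎

-- The suffix V = 1
-- preserves the shape needed by the two-twos operation.
record TopPairs (V L : List ℕ) : Set where
  constructor mkTopPairs
  field
    X : List ℕ
    α β : ℕ
    Y : List ℕ
    γ δ : ℕ
    W : List ℕ
    m : ℕ
    largest : α ∷ β ∷ γ ∷ δ ∷ [] ↭ map (m +_) (upTo 4)
    size : length L ≡ 3 + m
    realization : IsStandardLinearRealization L (0 ∷ X ++ α ∷ β ∷ Y ++ γ ∷ δ ∷ W ++ V)

-- Inserting four fours keeps this shape: the new largest entries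
-- α+4 β+4 and γ+4 δ+4 are again adjacent, and the suffix V is untouched.
addFourFours : ∀ {V L} → TopPairs V L → TopPairs V (4 ∷ 4 ∷ 4 ∷ 4 ∷ L)
addFourFours {V} t =
  mkTopPairs (X ++ α ∷ []) (4 + α) (4 + β) (β ∷ Y ++ γ ∷ []) (4 + γ) (4 + δ) (δ ∷ W) (4 + m)
    (map⁺ (4 +_) largest) (cong (4 +_) size)
    (subst (IsStandardLinearRealization _) regroup (insertFours m X α β Y γ δ (W ++ V) size largest realization))
  where
  open TopPairs t
  regroup : 0 ∷ X ++ α ∷ 4 + α ∷ 4 + β ∷ β ∷ Y ++ γ ∷ 4 + γ ∷ 4 + δ ∷ δ ∷ W ++ V
          ≡ 0 ∷ (X ++ α ∷ []) ++ 4 + α ∷ 4 + β ∷ (β ∷ Y ++ γ ∷ []) ++ 4 + γ ∷ 4 + δ ∷ δ ∷ W ++ V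
  regroup = cong (0 ∷_) (sym (trans (++-assoc X (α ∷ []) _)
              (cong (λ R → X ++ α ∷ 4 + α ∷ 4 + β ∷ β ∷ R) (++-assoc Y (γ ∷ []) _))))

transportTopPairs : ∀ {V L L′} → TopPairs V L → L ↭ L′ → TopPairs V L′
transportTopPairs (mkTopPairs X α β Y γ δ W m largest size realization) L↭L′ =
  mkTopPairs X α β Y γ δ W m largest (trans (sym (↭-length L↭L′)) size) (transport realization L↭L′)

topPairsRealizable : ∀ {V a b c d} → TopPairs V (list1234 a b c d) → Realizable a b c d
topPairsRealizable t = realizable (_ , TopPairs.realization t)

topPairsRealizable₁ : ∀ {a b c d} → TopPairs (1 ∷ []) (list1234 a b c d) → Realizable₁ a b c d
topPairsRealizable₁ (mkTopPairs X α β Y γ δ W m largest size realization) =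
  realizable₁ (X ++ α ∷ β ∷ Y ++ γ ∷ δ ∷ W , subst (IsStandardLinearRealization _) regroup realization)
  where
  regroup : 0 ∷ X ++ α ∷ β ∷ Y ++ γ ∷ δ ∷ W ++ 1 ∷ [] ≡ 0 ∷ (X ++ α ∷ β ∷ Y ++ γ ∷ δ ∷ W) ++ 1 ∷ []
  regroup = cong (0 ∷_) (sym (trans (++-assoc X _ (1 ∷ [])) (cong (λ R → X ++ α ∷ β ∷ R) (++-assoc Y _ (1 ∷ [])))))

-- Every d is 0,…,3 or 4,…,7 plus a multiple of 4; so a family P over d is
-- obtained from its members for d < 4 and from objects Q for 4 ≤ d < 8 that
-- can be advanced by 4 and yield members of P.
byFours : {P Q : ℕ → Set} → (∀ {d} → Q d → Q (4 + d)) → (∀ {d} → Q d → P d) →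
  P 0 → P 1 → P 2 → P 3 → Q 4 → Q 5 → Q 6 → Q 7 → ∀ d → P d
byFours {P} {Q} step done p₀ p₁ p₂ p₃ q₄ q₅ q₆ q₇ = family
  where
  advanced : ∀ d → Q (4 + d)
  advanced 0 = q₄
  advanced 1 = q₅
  advanced 2 = q₆
  advanced 3 = q₇
  advanced (suc (suc (suc (suc d)))) = step (advanced d)
  family : ∀ d → P d
  family 0 = p₀
  family 1 = p₁
  family 2 = p₂
  family 3 = p₃
  family (suc (suc (suc (suc d)))) = done (advanced d)

byFoursEven : {P Q : ℕ → Set} → (∀ {d} → Q d → Q (4 + d)) → (∀ {d} → Q d → P d) →
  P 0 → P 2 → Q 4 → Q 6 → ∀ e → P (e * 2)
byFoursEven {P} {Q} step done p₀ p₂ q₄ q₆ = family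
  where
  advanced : ∀ e → Q (4 + e * 2)
  advanced 0 = q₄
  advanced 1 = q₆
  advanced (suc (suc e)) = step (advanced e)
  family : ∀ e → P (e * 2)
  family 0 = p₀
  family 1 = p₂
  family (suc (suc e)) = done (advanced e)

addFours : ∀ {V a b c d} → TopPairs V (list1234 a b c d) → TopPairs V (list1234 a b c (4 + d))
addFours {a = a} {b} {c} {d} t = transportTopPairs (addFourFours t) (list1234-++ 0 0 0 4 a b c d)

allD : ∀ (R : ℕ → ℕ → ℕ → ℕ → Set) V a b c → (∀ {d} → TopPairs V (list1234 a b c d) → R a b c d) →
  R a b c 0 → R a b c 1 → R a b c 2 → R a b c 3 →
  TopPairs V (list1234 a b c 4) → TopPairs V (list1234 a b c 5) → TopPairs V (list1234 a b c 6) → TopPairs V (list1234 a b c 7) →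
  ∀ d → R a b c d
allD R V a b c = byFours {R a b c} {λ d → TopPairs V (list1234 a b c d)} (λ {d} → addFours {V} {a} {b} {c} {d})

allEvenD : ∀ (R : ℕ → ℕ → ℕ → ℕ → Set) V a b c → (∀ {d} → TopPairs V (list1234 a b c d) → R a b c d) →
  R a b c 0 → R a b c 2 → TopPairs V (list1234 a b c 4) → TopPairs V (list1234 a b c 6) → ∀ e → R a b c (e * 2)
allEvenD R V a b c = byFoursEven {R a b c} {λ d → TopPairs V (list1234 a b c d)} (λ {d} → addFours {V} {a} {b} {c} {d})

realizedBy : ∀ {a b c d} S → {T (is-just (standard? (list1234 a b c d) S))} → Realizable a b c d
realizedBy {a} {b} {c} {d} S {ok} = realizable (S , by-computation (standard? (list1234 a b c d) S) {ok})

topPairs? : ∀ V L X α β Y γ δ W → Maybe (TopPairs V L)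
topPairs? V L X α β Y γ δ W
  with length L ≟ 3 + (length L ∸ 3)
     | perm? (α ∷ β ∷ γ ∷ δ ∷ []) (map ((length L ∸ 3) +_) (upTo 4))
     | standard? L (0 ∷ X ++ α ∷ β ∷ Y ++ γ ∷ δ ∷ W ++ V)
... | yes size | just largest | just realization = just (mkTopPairs X α β Y γ δ W _ largest size realization)
... | _ | _ | _ = nothing

topPairsBy : ∀ {V L} X α β Y γ δ W → {T (is-just (topPairs? V L X α β Y γ δ W))} → TopPairs V L
topPairsBy {V} {L} X α β Y γ δ W {ok} = by-computation (topPairs? V L X α β Y γ δ W) {ok}

endingInOneBy : ∀ {a b c d} S₁ → {T (is-just (standard? (list1234 a b c d) (0 ∷ S₁ ++ 1 ∷ [])))} → Realizable₁ a b c d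
endingInOneBy {a} {b} {c} {d} S₁ {ok} = realizable₁ (S₁ , by-computation (standard? (list1234 a b c d) (0 ∷ S₁ ++ 1 ∷ [])) {ok})

family-3-0-0 : ∀ d → Realizable 3 0 0 d
family-3-0-0 = allD Realizable [] 3 0 0 topPairsRealizable
  (realizedBy (0 ∷ 1 ∷ 2 ∷ 3 ∷ []))
  (realizedBy (0 ∷ 4 ∷ 3 ∷ 2 ∷ 1 ∷ []))
  (realizedBy (0 ∷ 4 ∷ 3 ∷ 2 ∷ 1 ∷ 5 ∷ []))
  (realizedBy (0 ∷ 4 ∷ 3 ∷ 2 ∷ 6 ∷ 5 ∷ 1 ∷ []))
  (topPairsBy [] 4 5 (1 ∷ 2 ∷ []) 6 7 (3 ∷ []))
  (topPairsBy (4 ∷ []) 8 7 (3 ∷ 2 ∷ []) 6 5 (1 ∷ []))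
  (topPairsBy (4 ∷ []) 8 9 (5 ∷ 1 ∷ 2 ∷ []) 6 7 (3 ∷ []))
  (topPairsBy (4 ∷ []) 8 7 (3 ∷ 2 ∷ 6 ∷ []) 10 9 (5 ∷ 1 ∷ []))

family-4-0-1 : ∀ d → Realizable 4 0 1 d
family-4-0-1 = allD Realizable [] 4 0 1 topPairsRealizable
  (realizedBy (0 ∷ 1 ∷ 2 ∷ 5 ∷ 4 ∷ 3 ∷ []))
  (realizedBy (0 ∷ 1 ∷ 2 ∷ 6 ∷ 3 ∷ 4 ∷ 5 ∷ []))
  (realizedBy (0 ∷ 1 ∷ 2 ∷ 6 ∷ 5 ∷ 4 ∷ 7 ∷ 3 ∷ []))
  (realizedBy (0 ∷ 1 ∷ 2 ∷ 6 ∷ 5 ∷ 8 ∷ 4 ∷ 3 ∷ 7 ∷ []))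
  (topPairsBy (1 ∷ 2 ∷ []) 6 9 (5 ∷ 4 ∷ []) 8 7 (3 ∷ []))
  (topPairsBy (1 ∷ 2 ∷ 6 ∷ []) 10 7 (3 ∷ 4 ∷ []) 8 9 (5 ∷ []))
  (topPairsBy (1 ∷ 2 ∷ 6 ∷ []) 10 9 (5 ∷ 4 ∷ []) 8 11 (7 ∷ 3 ∷ []))
  (topPairsBy (1 ∷ 2 ∷ 6 ∷ []) 10 11 (7 ∷ 3 ∷ 4 ∷ 8 ∷ []) 12 9 (5 ∷ []))

family-2-1-0 : ∀ d → Realizable 2 1 0 d
family-2-1-0 = allD Realizable [] 2 1 0 topPairsRealizable
  (realizedBy (0 ∷ 1 ∷ 3 ∷ 2 ∷ []))
  (realizedBy (0 ∷ 4 ∷ 3 ∷ 1 ∷ 2 ∷ []))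
  (realizedBy (0 ∷ 4 ∷ 3 ∷ 5 ∷ 1 ∷ 2 ∷ []))
  (realizedBy (0 ∷ 4 ∷ 3 ∷ 1 ∷ 5 ∷ 6 ∷ 2 ∷ []))
  (topPairsBy [] 4 5 (1 ∷ 3 ∷ []) 7 6 (2 ∷ []))
  (topPairsBy (4 ∷ []) 8 7 (3 ∷ 1 ∷ []) 5 6 (2 ∷ []))
  (topPairsBy (4 ∷ []) 8 9 (5 ∷ 1 ∷ 3 ∷ []) 7 6 (2 ∷ []))
  (topPairsBy (4 ∷ []) 8 7 (3 ∷ 1 ∷ 5 ∷ []) 9 10 (6 ∷ 2 ∷ []))

family-2-3-0 : ∀ d → Realizable 2 3 0 d
family-2-3-0 = allD Realizable [] 2 3 0 topPairsRealizable
  (realizedBy (0 ∷ 1 ∷ 3 ∷ 5 ∷ 4 ∷ 2 ∷ []))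
  (realizedBy (0 ∷ 1 ∷ 3 ∷ 5 ∷ 4 ∷ 2 ∷ 6 ∷ []))
  (realizedBy (0 ∷ 1 ∷ 3 ∷ 7 ∷ 5 ∷ 4 ∷ 2 ∷ 6 ∷ []))
  (realizedBy (0 ∷ 1 ∷ 3 ∷ 7 ∷ 5 ∷ 4 ∷ 8 ∷ 6 ∷ 2 ∷ []))
  (topPairsBy (1 ∷ 3 ∷ []) 7 9 (5 ∷ 4 ∷ []) 8 6 (2 ∷ []))
  (topPairsBy (1 ∷ 3 ∷ []) 7 9 (5 ∷ 4 ∷ []) 8 10 (6 ∷ 2 ∷ []))
  (topPairsBy (1 ∷ 3 ∷ 7 ∷ []) 11 9 (5 ∷ 4 ∷ []) 8 10 (6 ∷ 2 ∷ []))
  (topPairsBy (1 ∷ 3 ∷ 7 ∷ []) 11 9 (5 ∷ 4 ∷ 8 ∷ []) 12 10 (6 ∷ 2 ∷ []))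

family-2-1-1 : ∀ d → Realizable 2 1 1 d
family-2-1-1 = allD Realizable [] 2 1 1 topPairsRealizable
  (realizedBy (0 ∷ 1 ∷ 4 ∷ 2 ∷ 3 ∷ []))
  (realizedBy (0 ∷ 1 ∷ 5 ∷ 2 ∷ 4 ∷ 3 ∷ []))
  (realizedBy (0 ∷ 1 ∷ 5 ∷ 4 ∷ 2 ∷ 6 ∷ 3 ∷ []))
  (realizedBy (0 ∷ 1 ∷ 5 ∷ 4 ∷ 2 ∷ 6 ∷ 3 ∷ 7 ∷ []))
  (topPairsBy (1 ∷ []) 5 8 (4 ∷ 2 ∷ []) 6 7 (3 ∷ []))
  (topPairsBy (1 ∷ 5 ∷ []) 9 6 (2 ∷ 4 ∷ []) 8 7 (3 ∷ []))
  (topPairsBy (1 ∷ 5 ∷ []) 9 8 (4 ∷ 2 ∷ 6 ∷ []) 10 7 (3 ∷ []))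
  (topPairsBy (1 ∷ 5 ∷ []) 9 10 (6 ∷ 2 ∷ 4 ∷ []) 8 11 (7 ∷ 3 ∷ []))

family₁-1-2-0 : ∀ d → Realizable₁ 1 2 0 d
family₁-1-2-0 = allD Realizable₁ (1 ∷ []) 1 2 0 topPairsRealizable₁
  (endingInOneBy (2 ∷ 3 ∷ []))
  (endingInOneBy (4 ∷ 2 ∷ 3 ∷ []))
  (endingInOneBy (4 ∷ 2 ∷ 3 ∷ 5 ∷ []))
  (endingInOneBy (4 ∷ 6 ∷ 2 ∷ 3 ∷ 5 ∷ []))
  (topPairsBy [] 4 6 (2 ∷ 3 ∷ []) 7 5 [])
  (topPairsBy (4 ∷ []) 8 6 (2 ∷ 3 ∷ []) 7 5 [])
  (topPairsBy (4 ∷ []) 8 6 (2 ∷ 3 ∷ []) 7 9 (5 ∷ []))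
  (topPairsBy (4 ∷ []) 8 10 (6 ∷ 2 ∷ 3 ∷ []) 7 9 (5 ∷ []))

family-2-0-2 : ∀ e → Realizable 2 0 2 (e * 2)
family-2-0-2 = allEvenD Realizable [] 2 0 2 topPairsRealizable
  (realizedBy (0 ∷ 3 ∷ 2 ∷ 1 ∷ 4 ∷ []))
  (realizedBy (0 ∷ 1 ∷ 5 ∷ 2 ∷ 6 ∷ 3 ∷ 4 ∷ []))
  (topPairsBy (3 ∷ []) 7 6 (2 ∷ 1 ∷ []) 5 8 (4 ∷ []))
  (topPairsBy (3 ∷ []) 7 8 (4 ∷ 1 ∷ 5 ∷ []) 9 10 (6 ∷ 2 ∷ []))

family-2-0-3 : ∀ e → Realizable 2 0 3 (e * 2)
family-2-0-3 = allEvenD Realizable [] 2 0 3 topPairsRealizable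
  (realizedBy (0 ∷ 3 ∷ 2 ∷ 5 ∷ 4 ∷ 1 ∷ []))
  (realizedBy (0 ∷ 1 ∷ 4 ∷ 5 ∷ 2 ∷ 6 ∷ 3 ∷ 7 ∷ []))
  (topPairsBy (3 ∷ []) 7 6 (2 ∷ 5 ∷ []) 9 8 (4 ∷ 1 ∷ []))
  (topPairsBy (3 ∷ 2 ∷ 6 ∷ []) 10 9 (5 ∷ 1 ∷ 4 ∷ []) 8 11 (7 ∷ []))

family₁-1-2-2 : ∀ e → Realizable₁ 1 2 2 (e * 2)
family₁-1-2-2 = allEvenD Realizable₁ (1 ∷ []) 1 2 2 topPairsRealizable₁
  (endingInOneBy (2 ∷ 5 ∷ 3 ∷ 4 ∷ []))
  (endingInOneBy (2 ∷ 4 ∷ 7 ∷ 3 ∷ 6 ∷ 5 ∷ []))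
  (topPairsBy (2 ∷ 4 ∷ []) 8 7 (3 ∷ []) 6 9 (5 ∷ []))
  (topPairsBy (2 ∷ 4 ∷ []) 8 11 (7 ∷ 3 ∷ 6 ∷ []) 10 9 (5 ∷ []))

evenTwos : ∀ q d → Realizable₁ 1 (suc q * 2) 0 d
evenTwos zero d = family₁-1-2-0 d
evenTwos (suc q) d = addTwoTwosAt (evenTwos q d)

oddTwos : ∀ q → Realizable₁ 1 (suc (q * 2)) 0 0
oddTwos zero = endingInOneBy (2 ∷ [])
oddTwos (suc q) = addTwoTwosAt (oddTwos q)

evenTwosTwoThrees : ∀ q e → Realizable₁ 1 (suc q * 2) 2 (e * 2)
evenTwosTwoThrees zero e = family₁-1-2-2 e
evenTwosTwoThrees (suc q) e = addTwoTwosAt (evenTwosTwoThrees q e)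

-- Case (1) with a = c + 3.  For c = 0, b = 2q+2 comes from {1,2^b} ending
-- in 1 by two 0 1 blocks; c = 1 comes from c = 0 by 0 3 1 2 4 when b > 0,
-- and c + 2 from c by 0 3 2 1 4.
case1-noThrees : ∀ q d → Realizable 3 (q * 2) 0 d
case1-noThrees zero d = family-3-0-0 d
case1-noThrees (suc q) d = addOne (addOne (forgetEnd (evenTwos q d)))

case1-tight : ∀ q c d → Realizable (c + 3) (q * 2) c d
case1-tight q 0 d = case1-noThrees q d
case1-tight zero 1 d = family-4-0-1 d
case1-tight (suc q) 1 d = addOneTwosThree (case1-noThrees q d)
case1-tight q (suc (suc c)) d = addOnesThrees (case1-tight q c d)

-- Case (2) with a = c + 2, b odd.  For c = 0 and b ≥ 5, d = 0 comes from
-- {1,2^b} ending in 1 and d > 0 from {1,2^(b-3),4^(d-1)} by 0 2 4 3 1 5.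
case2-noThrees : ∀ q d → Realizable 2 (suc (q * 2)) 0 d
case2-noThrees 0 d = family-2-1-0 d
case2-noThrees 1 d = family-2-3-0 d
case2-noThrees (suc (suc q)) 0 = addOne (forgetEnd (oddTwos (suc (suc q))))
case2-noThrees (suc (suc q)) (suc d) = addOneTwosFour (forgetEnd (evenTwos q d))

case2-tight : ∀ q c d → Realizable (c + 2) (suc (q * 2)) c d
case2-tight q 0 d = case2-noThrees q d
case2-tight zero 1 d = addOne (family-2-1-1 d)
case2-tight (suc q) 1 d = addOneTwosThree (case2-noThrees q d)
case2-tight q (suc (suc c)) d = addOnesThrees (case2-tight q c d)

case3-twoThrees : ∀ q e → Realizable 2 (q * 2) 2 (e * 2)
case3-twoThrees zero e = family-2-0-2 e
case3-twoThrees (suc q) e = addOne (forgetEnd (evenTwosTwoThrees q e))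

case3-tight : ∀ q c e → Realizable (2 + c) (q * 2) (2 + c) (e * 2)
case3-tight q 0 e = case3-twoThrees q e
case3-tight zero 1 e = addOne (family-2-0-3 e)
case3-tight (suc q) 1 e = addOneTwosThree (case3-twoThrees q e)
case3-tight q (suc (suc c)) e = addOnesThrees (case3-tight q c e)

upFrom : ∀ {P : ℕ → Set} → (∀ {n} → P n → P (suc n)) → ∀ {m n} → m ≤ n → P m → P n
upFrom {P} step m≤n = go (≤⇒≤‴ m≤n)
  where
  go : ∀ {m n} → m ≤‴ n → P m → P n
  go ≤‴-refl p = p
  go (≤‴-step m<n) p = go m<n (step p)

moreOnes : ∀ {a a′ b c d} → a ≤ a′ → Realizable a b c d → Realizable a′ b c d
moreOnes {b = b} {c} {d} = upFrom {λ n → Realizable n b c d} addOne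

odd-form : ∀ b → ¬ 2 ∣ b → Σ ℕ λ q → b ≡ suc (q * 2)
odd-form zero b-odd = contradiction (divides 0 refl) b-odd
odd-form (suc zero) _ = 0 , refl
odd-form (suc (suc b)) b-odd with odd-form b (λ { (divides q b≡2q) → b-odd (divides (suc q) (cong (2 +_) b≡2q)) })
... | q , refl = suc q , refl

-- Each case reduces to its extremal value of a, further 1s being added by
-- 0 1 blocks; b and d are written as 2q (+1) and 2e.
proposition5p3 : (a b c d : ℕ) →
    ((3 ≤ a) × (2 ∣ b) × (c + 3 ≤ a))
    ⊎ ((2 ≤ a) × ¬ (2 ∣ b) × (c + 2 ≤ a))
    ⊎ ((2 ≤ a) × (2 ∣ b) × (2 ≤ c) × (c ≤ a) × (2 ∣ d)) →
    HasStandardLinearRealization (list1234 a b c d)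
proposition5p3 a b c d (inj₁ (_ , divides q refl , c+3≤a)) = Realizable.witness (moreOnes c+3≤a (case1-tight q c d))
proposition5p3 a b c d (inj₂ (inj₁ (_ , b-odd , c+2≤a))) with odd-form b b-odd
... | q , refl = Realizable.witness (moreOnes c+2≤a (case2-tight q c d))
proposition5p3 a b c d (inj₂ (inj₂ (_ , divides q refl , s≤s (s≤s z≤n) , c≤a , divides e refl))) =
  Realizable.witness (moreOnes c≤a (case3-tight q _ e))
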